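{- Let $\lambda=(1^{a_1},\ldots,m^{a_m})$ with all $a_i\ge1$ and $m\ge2$. If $a_1=1$, then $\mathrm{Aut}(\mathrm{GT}_\lambda)$ contains a subgroup isomorphic to the symmetric group $S_{a_2}$. Similarly, if $a_m=1$, then $\mathrm{Aut}(\mathrm{GT}_\lambda)$ contains a subgroup isomorphic to $S_{a_{m-1}}$.
   Context: For $\lambda=(\lambda_1\le\cdots\le\lambda_n)$, $\mathrm{GT}_\lambda$ is the set of $(x_{i,j})_{1\le j\le i\le n}\in\mathbb{R}^{n(n+1)/2}$ with $x_{i,i}=\lambda_i$ and $x_{i-1,j}\le x_{i,j}\le x_{i+1,j}$, $x_{i,j-1}\le x_{i,j}\le x_{i,j+1}$ whenever indices lie in $\{(i,j):1\le j\le i\le n\}$. The notation $(1^{a_1},\ldots,m^{a_m})$ means $a_1$ copies of $1$, then $a_2$ copies of $2$, etc. $\mathrm{Aut}(\mathrm{GT}_\lambda)$ is the group of automorphisms of the face poset of $\mathrm{GT}_\lambda$.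
   Formalization: The points of GT_λ have rational coordinates, lying in ℚ^(n(n+1)/2) rather than $\mathbb{R}^{n(n+1)/2}$, so its faces and their inclusions are compared on rational points. -}

module Defs where

open import Data.Nat using (ℕ; zero; suc; _+_; _∸_; _≤_)
open import Data.Integer using (+_)
open import Data.Rational using (ℚ; _/_) renaming (_≤_ to _≤ℚ_)
open import Data.List using (List; []; _∷_; replicate; _++_; length)
open import Data.List.Relation.Unary.All using (All)
open import Data.Product using (_×_; _,_; proj₁; proj₂; Σ; ∃)
open import Data.Sum using (_⊎_)
open import Data.Fin.Permutation using (Permutation′; _∘ₚ_; _⟨$⟩ʳ_)
open import Relation.Binary.PropositionalEquality using (_≡_)

-- 1-indexed list access (default 0 out of range)
nth : List ℕ → ℕ → ℕ
nth [] _ = 0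
nth (x ∷ xs) zero = 0
nth (x ∷ xs) (suc zero) = x
nth (x ∷ xs) (suc (suc k)) = nth xs (suc k)

entries : ℕ → List ℕ → List ℕ
entries k [] = []
entries k (a ∷ as) = replicate a k ++ entries (suc k) as

lam : List ℕ → List ℕ
lam a = entries 1 a

sumL : List ℕ → ℕ
sumL [] = 0
sumL (x ∷ xs) = x + sumL xs

Idx : Set
Idx = ℕ × ℕ

ValidIdx : ℕ → Idx → Set
ValidIdx n (i , j) = (1 ≤ j) × (j ≤ i) × (i ≤ n)

-- an edge (p , q) encodes the defining inequality x_p ≤ x_q between
-- adjacent positions: vertical x_{i-1,j} ≤ x_{i,j} or horizontal x_{i,j-1} ≤ x_{i,j}
IsEdge : ℕ → Idx × Idx → Set
IsEdge n ((i' , j') , (i , j)) =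
  ValidIdx n (i' , j') × ValidIdx n (i , j) ×
  (((suc i' ≡ i) × (j' ≡ j)) ⊎ ((i' ≡ i) × (suc j' ≡ j)))

Point : Set
Point = ℕ → ℕ → ℚ

ℕ→ℚ : ℕ → ℚ
ℕ→ℚ k = (+ k) / 1

InGT : List ℕ → Point → Set
InGT l x =
  ((i : ℕ) → 1 ≤ i → i ≤ length l → x i i ≡ ℕ→ℚ (nth l i)) ×
  ((e : Idx × Idx) → IsEdge (length l) e →
     x (proj₁ (proj₁ e)) (proj₂ (proj₁ e)) ≤ℚ x (proj₁ (proj₂ e)) (proj₂ (proj₂ e)))

-- a face is given by a set of defining inequalities made tight
FaceRep : ℕ → Set
FaceRep n = Σ (List (Idx × Idx)) (All (IsEdge n))

Tight : {n : ℕ} → FaceRep n → Point → Set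
Tight (S , _) x =
  All (λ e → x (proj₁ (proj₁ e)) (proj₂ (proj₁ e)) ≡ x (proj₁ (proj₂ e)) (proj₂ (proj₂ e))) S

Sub : (l : List ℕ) → FaceRep (length l) → FaceRep (length l) → Set
Sub l F G = (x : Point) → InGT l x → Tight F x → Tight G x

Same : (l : List ℕ) → FaceRep (length l) → FaceRep (length l) → Set
Same l F G = Sub l F G × Sub l G F

record Aut (l : List ℕ) : Set where
  field
    fun : FaceRep (length l) → FaceRep (length l)
    preserves : ∀ F G → Sub l F G → Sub l (fun F) (fun G)
    reflects : ∀ F G → Sub l (fun F) (fun G) → Sub l F G
    surjective : ∀ G → ∃ λ F → Same l (fun F) G
open Aut public

-- Aut(GT_l) contains a subgroup isomorphic to S_k:
-- an injective group homomorphism S_k → Aut(GT_l)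
-- (∘ₚ is diagrammatic: (σ ∘ₚ τ) i = τ (σ i))
ContainsSym : List ℕ → ℕ → Set
ContainsSym l k =
  Σ (Permutation′ k → Aut l) λ φ →
    ((σ τ : Permutation′ k) (F : FaceRep (length l)) →
       Same l (fun (φ (σ ∘ₚ τ)) F) (fun (φ τ) (fun (φ σ) F))) ×
    ((σ : Permutation′ k) → ((F : FaceRep (length l)) → Same l (fun (φ σ) F) F) →
       ∀ i → σ ⟨$⟩ʳ i ≡ i)

-- Let λ₁ < λ₂ = ⋯ = λ_{k+1} = b.  In a pattern of GT_λ the entries x_{t,2} with
-- 2 ≤ t ≤ k+1 are forced to equal b, so the first column x₁₁ ≤ x₂₁ ≤ ⋯ ≤ x_{k+1,1}
-- meets the rest of the pattern only through x_{t,1} ≤ b.  Permuting the k gaps of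
-- this column (keeping x₁₁ and x_{k+1,1}) is therefore an affine bijection of GT_λ.
-- It permutes the facets "gap s closes", and the face x_{t,1} = x_{t,2} becomes
-- "all later gaps close and x_{k+1,1} = b".  The resulting action of S_k on the face
-- poset is faithful because any single gap can be made the only open one.
-- The case a_m = 1 reduces to a₁ = 1: x_{i,j} ↦ (m+1) − x_{N+1−j,N+1−i} maps GT_λ
-- onto GT_λ* for the reversed block sizes, and conjugation carries the subgroup over.

{-# OPTIONS --safe #-}
module Submission where

open import Defs
import Algebra.Properties.AbelianGroup as AbelianGroupProperties
import Algebra.Properties.CommutativeMonoid.Sum as MonoidSum
open import Data.Empty using (⊥; ⊥-elim)
open import Data.Fin as Fin using (Fin; toℕ; fromℕ<)
import Data.Fin.Properties as FinP
open import Data.Fin.Permutation as Perm using (Permutation′; _∘ₚ_; _⟨$⟩ʳ_)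
open import Data.Integer as ℤ using (+_)
import Data.Integer.Properties as ℤP
open import Data.List using (List; []; _∷_; _++_; length; map; replicate; reverse; tabulate)
import Data.List.Properties as ListP
open import Data.List.Relation.Unary.All as All using (All; []; _∷_)
import Data.List.Relation.Unary.All.Properties as AllP
open import Data.List.Relation.Unary.AllPairs using (AllPairs; []; _∷_)
import Data.List.Relation.Unary.AllPairs.Properties as AllPairsP
open import Data.Nat using (ℕ; zero; suc; _+_; _∸_; _≤_; _<_; z≤n; s≤s; _<?_)
import Data.Nat.Coprimality as Coprimality
import Data.Nat.Properties as ℕP
open import Data.Product using (_×_; _,_; proj₁; proj₂; Σ-syntax)
open import Data.Rational as ℚ using (ℚ; mkℚ; 0ℚ; -_; _-_) renaming (_+_ to _+ℚ_; _≤_ to _≤ℚ_)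
import Data.Rational.Properties as ℚP
open import Data.Sum using (inj₁; inj₂)
open import Function using (_∘_; _∘′_)
open import Level using (0ℓ)
open import Relation.Binary.Bundles using (Preorder)
import Relation.Binary.Reasoning.Preorder as PreorderReasoning
open import Relation.Binary.PropositionalEquality
open import Relation.Nullary using (¬_; yes; no)

module ℚ-Group = AbelianGroupProperties ℚP.+-0-abelianGroup
module ℚ-Sum = MonoidSum ℚP.+-0-commutativeMonoid

ℕ→ℚ≡mkℚ : ∀ k → ℕ→ℚ k ≡ mkℚ (+ k) 0 (Coprimality.sym (Coprimality.1-coprimeTo k))
ℕ→ℚ≡mkℚ k = ℚP.normalize-coprime (Coprimality.sym (Coprimality.1-coprimeTo k))

ℕ→ℚ-injective : ∀ {a b} → ℕ→ℚ a ≡ ℕ→ℚ b → a ≡ b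
ℕ→ℚ-injective {a} {b} eq =
  ℤP.+-injective (cong ℚ.↥_ (trans (sym (ℕ→ℚ≡mkℚ a)) (trans eq (ℕ→ℚ≡mkℚ b))))

ℕ→ℚ-mono-≤ : ∀ {a b} → a ≤ b → ℕ→ℚ a ≤ℚ ℕ→ℚ b
ℕ→ℚ-mono-≤ {a} {b} a≤b rewrite ℕ→ℚ≡mkℚ a | ℕ→ℚ≡mkℚ b =
  ℚ.*≤* (subst₂ ℤ._≤_ (sym (ℤP.*-identityʳ (+ a))) (sym (ℤP.*-identityʳ (+ b))) (ℤ.+≤+ a≤b))

ℕ→ℚ-homo-+ : ∀ a b → ℕ→ℚ (a + b) ≡ ℕ→ℚ a +ℚ ℕ→ℚ b
ℕ→ℚ-homo-+ a b rewrite ℕ→ℚ≡mkℚ a | ℕ→ℚ≡mkℚ b =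
  cong (ℚ._/ 1) (cong₂ ℤ._+_ (sym (ℤP.*-identityʳ (+ a))) (sym (ℤP.*-identityʳ (+ b))))

q-p≡0⇒p≡q : ∀ {p q} → q - p ≡ 0ℚ → p ≡ q
q-p≡0⇒p≡q {p} {q} eq = sym (ℚ-Group.x∙y⁻¹≈ε⇒x≈y q p eq)

p≡q⇒q-p≡0 : ∀ {p q} → p ≡ q → q - p ≡ 0ℚ
p≡q⇒q-p≡0 eq = ℚ-Group.x≈y⇒x∙y⁻¹≈ε (sym eq)

p≤q⇒0≤q-p : ∀ {p q} → p ≤ℚ q → 0ℚ ≤ℚ q - p
p≤q⇒0≤q-p {p} {q} p≤q = subst (_≤ℚ q - p) (ℚP.+-inverseʳ p) (ℚP.+-monoˡ-≤ (- p) p≤q)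

0≤q-p⇒p≤q : ∀ {p q} → 0ℚ ≤ℚ q - p → p ≤ℚ q
0≤q-p⇒p≤q {p} {q} 0≤q-p =
  subst₂ _≤ℚ_ (ℚP.+-identityˡ p) (ℚ-Group.//-rightDividesˡ p q) (ℚP.+-monoˡ-≤ p 0≤q-p)

[p+q]-p≡q : ∀ p q → (p +ℚ q) - p ≡ q
[p+q]-p≡q = ℚ-Group.xyx⁻¹≈y

[p+q]-q≡p : ∀ p q → (p +ℚ q) - q ≡ p
[p+q]-q≡p p q = ℚ-Group.//-rightDividesʳ q p

p-q≡p-r⇒q≡r : ∀ p {q r} → p - q ≡ p - r → q ≡ r
p-q≡p-r⇒q≡r p {q} {r} eq = ℚP.neg-injective (ℚ-Group.∙-cancelˡ p (- q) (- r) eq)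

q≤r⇒p-r≤p-q : ∀ p {q r} → q ≤ℚ r → p - r ≤ℚ p - q
q≤r⇒p-r≤p-q p q≤r = ℚP.+-monoʳ-≤ p (ℚP.neg-antimono-≤ q≤r)

p-[p-q]≡q : ∀ p q → p - (p - q) ≡ q
p-[p-q]≡q p q = begin
  p +ℚ - (p - q)   ≡⟨ cong (p +ℚ_) (ℚ-Group.⁻¹-anti-homo‿- p q) ⟩
  p +ℚ (q - p)     ≡⟨ sym (ℚP.+-assoc p q (- p)) ⟩
  (p +ℚ q) - p     ≡⟨ [p+q]-p≡q p q ⟩
  q                ∎
  where open ≡-Reasoning

prefixSum : ∀ {k} → (Fin k → ℚ) → ℕ → ℚ
prefixSum w zero = 0ℚ
prefixSum {zero} w (suc r) = 0ℚ
prefixSum {suc k} w (suc r) = w Fin.zero +ℚ prefixSum (λ s → w (Fin.suc s)) r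

prefixSum-suc : ∀ {k} (w : Fin k → ℚ) {r} (r<k : r < k) →
                prefixSum w (suc r) ≡ prefixSum w r +ℚ w (fromℕ< r<k)
prefixSum-suc {suc k} w {zero} _ = ℚP.+-comm (w Fin.zero) 0ℚ
prefixSum-suc {suc k} w {suc r} (s≤s r<k) = begin
  w Fin.zero +ℚ prefixSum w′ (suc r)
    ≡⟨ cong (w Fin.zero +ℚ_) (prefixSum-suc w′ r<k) ⟩
  w Fin.zero +ℚ (prefixSum w′ r +ℚ w′ (fromℕ< r<k))
    ≡⟨ ℚP.+-assoc (w Fin.zero) (prefixSum w′ r) (w′ (fromℕ< r<k)) ⟨
  (w Fin.zero +ℚ prefixSum w′ r) +ℚ w′ (fromℕ< r<k)
    ∎
  where
  open ≡-Reasoning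
  w′ : Fin k → ℚ
  w′ s = w (Fin.suc s)

prefixSum-total : ∀ {k} (w : Fin k → ℚ) → prefixSum w k ≡ ℚ-Sum.sum w
prefixSum-total {zero} w = refl
prefixSum-total {suc k} w = cong (w Fin.zero +ℚ_) (prefixSum-total (λ s → w (Fin.suc s)))

prefixSum-cong : ∀ {k} {w w′ : Fin k → ℚ} → (∀ s → w s ≡ w′ s) →
                 ∀ r → prefixSum w r ≡ prefixSum w′ r
prefixSum-cong eq zero = refl
prefixSum-cong {zero} eq (suc r) = refl
prefixSum-cong {suc k} eq (suc r) = cong₂ _+ℚ_ (eq Fin.zero) (prefixSum-cong (λ s → eq (Fin.suc s)) r)

module MonotoneSequence (c : ℕ → ℚ) (K : ℕ) (step : ∀ m → m < K → c m ≤ℚ c (suc m)) where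

  FlatFrom : ℕ → Set
  FlatFrom a = ∀ m → a ≤ m → m < K → c m ≡ c (suc m)

  mono : ∀ {a b} → a ≤ b → b ≤ K → c a ≤ℚ c b
  mono {b = zero} z≤n _ = ℚP.≤-refl
  mono {a} {suc b} a≤1+b 1+b≤K with ℕP.m≤n⇒m<n∨m≡n a≤1+b
  ... | inj₂ refl = ℚP.≤-refl
  ... | inj₁ (s≤s a≤b) = ℚP.≤-trans (mono a≤b (ℕP.<⇒≤ 1+b≤K)) (step b 1+b≤K)

  flat⇒const : ∀ {a b} → FlatFrom a → a ≤ b → b ≤ K → c a ≡ c b
  flat⇒const {b = zero} flat z≤n _ = refl
  flat⇒const {a} {suc b} flat a≤1+b 1+b≤K with ℕP.m≤n⇒m<n∨m≡n a≤1+b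
  ... | inj₂ refl = refl
  ... | inj₁ (s≤s a≤b) = trans (flat⇒const flat a≤b (ℕP.<⇒≤ 1+b≤K)) (flat b a≤b 1+b≤K)

  reachesBound⇒flat : ∀ {a B} → a ≤ K → c K ≤ℚ B → c a ≡ B → FlatFrom a × c K ≡ B
  reachesBound⇒flat {a} {B} a≤K cK≤B ca≡B = flat , cK≡B
    where
    cK≡B : c K ≡ B
    cK≡B = ℚP.≤-antisym cK≤B (subst (_≤ℚ c K) ca≡B (mono a≤K ℕP.≤-refl))
    flat : FlatFrom a
    flat m a≤m m<K = ℚP.≤-antisym (step m m<K) (begin
      c (suc m)  ≤⟨ mono m<K ℕP.≤-refl ⟩
      c K        ≡⟨ trans cK≡B (sym ca≡B) ⟩
      c a        ≤⟨ mono a≤m (ℕP.<⇒≤ m<K) ⟩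
      c m        ∎)
      where open ℚP.≤-Reasoning

  flat⇒reachesBound : ∀ {a B} → a ≤ K → FlatFrom a → c K ≡ B → c a ≡ B
  flat⇒reachesBound a≤K flat cK≡B = trans (flat⇒const flat a≤K ℕP.≤-refl) cK≡B

TightAt : Point → Idx × Idx → Set
TightAt x ((i′ , j′) , (i , j)) = x i′ j′ ≡ x i j

Holds : Point → Idx × Idx → Set
Holds x ((i′ , j′) , (i , j)) = x i′ j′ ≤ℚ x i j

_≗₂_ : Point → Point → Set
x ≗₂ y = ∀ i j → x i j ≡ y i j

AgreeOn : ℕ → Point → Point → Set
AgreeOn n x y = ∀ i j → ValidIdx n (i , j) → x i j ≡ y i j

≗₂⇒AgreeOn : ∀ {n x y} → x ≗₂ y → AgreeOn n x y
≗₂⇒AgreeOn x≗y i j _ = x≗y i j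

≗₂-sym : ∀ {x y} → x ≗₂ y → y ≗₂ x
≗₂-sym x≗y i j = sym (x≗y i j)

Tight-resp : ∀ {n x y} → AgreeOn n x y → (F : FaceRep n) → Tight F x → Tight F y
Tight-resp x≈y ([] , []) [] = []
Tight-resp x≈y ((((i′ , j′) , (i , j)) ∷ S) , ((p , q , _) ∷ ps)) (t ∷ ts) =
  trans (sym (x≈y i′ j′ p)) (trans t (x≈y i j q)) ∷ Tight-resp x≈y (S , ps) ts

facePreorder : List ℕ → Preorder 0ℓ 0ℓ 0ℓ
facePreorder l = record
  { Carrier = FaceRep (length l)
  ; _≈_ = Same l
  ; _≲_ = Sub l
  ; isPreorder = record
    { isEquivalence = record
      { refl = (λ _ _ t → t) , (λ _ _ t → t)
      ; sym = λ (F⊆G , G⊆F) → G⊆F , F⊆G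
      ; trans = λ {F} {G} {H} (F⊆G , G⊆F) (G⊆H , H⊆G) →
          ⊆-trans {F} {G} {H} F⊆G G⊆H , ⊆-trans {H} {G} {F} H⊆G G⊆F
      }
    ; reflexive = proj₁
    ; trans = λ {F} {G} {H} → ⊆-trans {F} {G} {H}
    }
  }
  where
  ⊆-trans : ∀ {F G H} → Sub l F G → Sub l G H → Sub l F H
  ⊆-trans F⊆G G⊆H x x∈GT = G⊆H x x∈GT ∘′ F⊆G x x∈GT

module FaceReasoning (l : List ℕ) = PreorderReasoning (facePreorder l)

Aut-preserves-Same : ∀ {l} (A : Aut l) {F G} → Same l F G → Same l (fun A F) (fun A G)
Aut-preserves-Same A {F} {G} (F⊆G , G⊆F) = preserves A F G F⊆G , preserves A G F G⊆F

module _ {l : List ℕ} {x : Point} (x∈GT : InGT l x) where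

  column-mono : ∀ {i i′ j} → 1 ≤ j → j ≤ i → i ≤ i′ → i′ ≤ length l → x i j ≤ℚ x i′ j
  column-mono {i′ = zero} _ _ z≤n _ = ℚP.≤-refl
  column-mono {i} {suc i′} {j} 1≤j j≤i i≤1+i′ 1+i′≤n with ℕP.m≤n⇒m<n∨m≡n i≤1+i′
  ... | inj₂ refl = ℚP.≤-refl
  ... | inj₁ (s≤s i≤i′) = ℚP.≤-trans (column-mono 1≤j j≤i i≤i′ i′≤n)
          (proj₂ x∈GT ((i′ , j) , (suc i′ , j))
            ((1≤j , j≤i′ , i′≤n) , (1≤j , ℕP.m≤n⇒m≤1+n j≤i′ , 1+i′≤n) , inj₁ (refl , refl)))
    where
    i′≤n : i′ ≤ length l
    i′≤n = ℕP.<⇒≤ 1+i′≤n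
    j≤i′ : j ≤ i′
    j≤i′ = ℕP.≤-trans j≤i i≤i′

  row-mono : ∀ {i j j′} → 1 ≤ j → j ≤ j′ → j′ ≤ i → i ≤ length l → x i j ≤ℚ x i j′
  row-mono {j′ = zero} _ z≤n _ _ = ℚP.≤-refl
  row-mono {i} {j} {suc j′} 1≤j j≤1+j′ 1+j′≤i i≤n with ℕP.m≤n⇒m<n∨m≡n j≤1+j′
  ... | inj₂ refl = ℚP.≤-refl
  ... | inj₁ (s≤s j≤j′) = ℚP.≤-trans (row-mono 1≤j j≤j′ j′≤i i≤n)
          (proj₂ x∈GT ((i , j′) , (i , suc j′))
            ((ℕP.≤-trans 1≤j j≤j′ , j′≤i , i≤n) , (s≤s z≤n , 1+j′≤i , i≤n) , inj₂ (refl , refl)))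
    where
    j′≤i : j′ ≤ i
    j′≤i = ℕP.<⇒≤ 1+j′≤i

  squeeze : ∀ {i j} → 1 ≤ j → j ≤ i → i ≤ length l → nth l j ≡ nth l i → x i j ≡ ℕ→ℚ (nth l j)
  squeeze {i} {j} 1≤j j≤i i≤n λⱼ≡λᵢ = ℚP.≤-antisym
    (subst (x i j ≤ℚ_) (trans (proj₁ x∈GT i 1≤i i≤n) (cong ℕ→ℚ (sym λⱼ≡λᵢ)))
      (row-mono {i} {j} {i} 1≤j j≤i ℕP.≤-refl i≤n))
    (subst (_≤ℚ x i j) (proj₁ x∈GT j 1≤j (ℕP.≤-trans j≤i i≤n))
      (column-mono {j} {i} 1≤j ℕP.≤-refl j≤i i≤n))
    where
    1≤i : 1 ≤ i
    1≤i = ℕP.≤-trans 1≤j j≤i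

record GTSymmetry (l : List ℕ) : Set where
  field
    act : Point → Point
    pullback : FaceRep (length l) → FaceRep (length l)
    act-InGT : ∀ {x} → InGT l x → InGT l (act x)
    pullback-tight⁺ : ∀ {x} → InGT l x → ∀ F → Tight F (act x) → Tight (pullback F) x
    pullback-tight⁻ : ∀ {x} → InGT l x → ∀ F → Tight (pullback F) x → Tight F (act x)
open GTSymmetry

module _ {l : List ℕ} where

  idSymmetry : GTSymmetry l
  idSymmetry = record
    { act = λ x → x
    ; pullback = λ F → F
    ; act-InGT = λ x∈GT → x∈GT
    ; pullback-tight⁺ = λ _ _ t → t
    ; pullback-tight⁻ = λ _ _ t → t
    }

  pullback-mono : (g : GTSymmetry l) → ∀ F G → Sub l F G → Sub l (pullback g F) (pullback g G)
  pullback-mono g F G F⊆G x x∈GT =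
    pullback-tight⁺ g x∈GT G ∘′ F⊆G (act g x) (act-InGT g x∈GT) ∘′ pullback-tight⁻ g x∈GT F

  pullback-∘ : (g h gh : GTSymmetry l) → (∀ x → act g (act h x) ≗₂ act gh x) →
               ∀ F → Same l (pullback gh F) (pullback h (pullback g F))
  pullback-∘ g h gh g∘h≗gh F = to , from
    where
    to : Sub l (pullback gh F) (pullback h (pullback g F))
    to x x∈GT = pullback-tight⁺ h x∈GT (pullback g F)
              ∘′ pullback-tight⁺ g (act-InGT h x∈GT) F
              ∘′ Tight-resp (≗₂⇒AgreeOn (≗₂-sym (g∘h≗gh x))) F
              ∘′ pullback-tight⁻ gh x∈GT F
    from : Sub l (pullback h (pullback g F)) (pullback gh F)
    from x x∈GT = pullback-tight⁺ gh x∈GT F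
                ∘′ Tight-resp (≗₂⇒AgreeOn (g∘h≗gh x)) F
                ∘′ pullback-tight⁻ g (act-InGT h x∈GT) F
                ∘′ pullback-tight⁻ h x∈GT (pullback g F)

  pullback-cancel : (g h : GTSymmetry l) → (∀ x → act g (act h x) ≗₂ x) →
                    ∀ F → Same l F (pullback h (pullback g F))
  pullback-cancel g h g∘h≗id = pullback-∘ g h idSymmetry g∘h≗id

  symmetryAut : (g g⁻¹ : GTSymmetry l) →
                (∀ x → act g (act g⁻¹ x) ≗₂ x) → (∀ x → act g⁻¹ (act g x) ≗₂ x) → Aut l
  fun (symmetryAut g g⁻¹ _ _) = pullback g
  preserves (symmetryAut g g⁻¹ _ _) = pullback-mono g
  reflects (symmetryAut g g⁻¹ g∘g⁻¹≗id _) F G gF⊆gG = begin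
    F                            ≈⟨ pullback-cancel g g⁻¹ g∘g⁻¹≗id F ⟩
    pullback g⁻¹ (pullback g F)  ≲⟨ pullback-mono g⁻¹ (pullback g F) (pullback g G) gF⊆gG ⟩
    pullback g⁻¹ (pullback g G)  ≈⟨ pullback-cancel g g⁻¹ g∘g⁻¹≗id G ⟨
    G                            ∎
    where open FaceReasoning l
  surjective (symmetryAut g g⁻¹ _ g⁻¹∘g≗id) G = pullback g⁻¹ G , (begin-equality
    pullback g (pullback g⁻¹ G)  ≈⟨ pullback-cancel g⁻¹ g g⁻¹∘g≗id G ⟨
    G                            ∎)
    where open FaceReasoning l

record FaceIso (l l′ : List ℕ) : Set where
  field
    to : FaceRep (length l) → FaceRep (length l′)
    from : FaceRep (length l′) → FaceRep (length l)
    to-mono : ∀ F G → Sub l F G → Sub l′ (to F) (to G)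
    from-mono : ∀ F G → Sub l′ F G → Sub l (from F) (from G)
    from-to : ∀ F → Same l (from (to F)) F
    to-from : ∀ G → Same l′ (to (from G)) G

module _ {l l′ : List ℕ} (iso : FaceIso l l′) where
  open FaceIso iso

  to-preserves-Same : ∀ {F G} → Same l F G → Same l′ (to F) (to G)
  to-preserves-Same {F} {G} (F⊆G , G⊆F) = to-mono F G F⊆G , to-mono G F G⊆F

  from-preserves-Same : ∀ {F G} → Same l′ F G → Same l (from F) (from G)
  from-preserves-Same {F} {G} (F⊆G , G⊆F) = from-mono F G F⊆G , from-mono G F G⊆F

  from-reflects : ∀ F G → Sub l (from F) (from G) → Sub l′ F G
  from-reflects F G fF⊆fG = begin
    F                ≈⟨ to-from F ⟨
    to (from F)      ≲⟨ to-mono (from F) (from G) fF⊆fG ⟩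
    to (from G)      ≈⟨ to-from G ⟩
    G                ∎
    where open FaceReasoning l′

  conjugate : Aut l′ → Aut l
  fun (conjugate A) = from ∘′ fun A ∘′ to
  preserves (conjugate A) F G F⊆G = from-mono _ _ (preserves A _ _ (to-mono F G F⊆G))
  reflects (conjugate A) F G AF⊆AG = begin
    F            ≈⟨ from-to F ⟨
    from (to F)  ≲⟨ from-mono (to F) (to G) (reflects A (to F) (to G) (from-reflects _ _ AF⊆AG)) ⟩
    from (to G)  ≈⟨ from-to G ⟩
    G            ∎
    where open FaceReasoning l
  surjective (conjugate A) G with surjective A (to G)
  ... | F , AF≈toG = from F , (begin-equality
    from (fun A (to (from F)))  ≈⟨ from-preserves-Same (Aut-preserves-Same A (to-from F)) ⟩
    from (fun A F)              ≈⟨ from-preserves-Same AF≈toG ⟩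
    from (to G)                 ≈⟨ from-to G ⟩
    G                           ∎)
    where open FaceReasoning l

  ContainsSym-transport : ∀ {k} → ContainsSym l′ k → ContainsSym l k
  ContainsSym-transport (φ , φ-hom , φ-faithful) = conjugate ∘′ φ , hom , faithful
    where
    hom : ∀ σ τ F → Same l (fun (conjugate (φ (σ ∘ₚ τ))) F)
                            (fun (conjugate (φ τ)) (fun (conjugate (φ σ)) F))
    hom σ τ F = from-preserves-Same (begin-equality
      fun (φ (σ ∘ₚ τ)) (to F)                      ≈⟨ φ-hom σ τ (to F) ⟩
      fun (φ τ) (fun (φ σ) (to F))                 ≈⟨ Aut-preserves-Same (φ τ) (to-from _) ⟨
      fun (φ τ) (to (from (fun (φ σ) (to F))))     ∎)
      where open FaceReasoning l′
    faithful : ∀ σ → (∀ F → Same l (fun (conjugate (φ σ)) F) F) → ∀ i → σ ⟨$⟩ʳ i ≡ i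
    faithful σ fixes = φ-faithful σ λ G → begin-equality
      fun (φ σ) G                                   ≈⟨ Aut-preserves-Same (φ σ) (to-from G) ⟨
      fun (φ σ) (to (from G))                       ≈⟨ to-from _ ⟨
      to (from (fun (φ σ) (to (from G))))           ≈⟨ to-preserves-Same (fixes (from G)) ⟩
      to (from G)                                   ≈⟨ to-from G ⟩
      G                                             ∎
      where open FaceReasoning l′

_∩ᶠ_ : ∀ {n} → FaceRep n → FaceRep n → FaceRep n
(S , S⊆E) ∩ᶠ (S′ , S′⊆E) = S ++ S′ , AllP.++⁺ S⊆E S′⊆E

∩ᶠ-tight⁺ : ∀ {n} {x} (F G : FaceRep n) → Tight F x → Tight G x → Tight (F ∩ᶠ G) x
∩ᶠ-tight⁺ F G = AllP.++⁺

∩ᶠ-tight⁻ : ∀ {n} {x} (F G : FaceRep n) → Tight (F ∩ᶠ G) x → Tight F x × Tight G x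
∩ᶠ-tight⁻ F G = AllP.++⁻ (proj₁ F)

zero-of : ∀ {k} → Fin k → Σ[ z ∈ Fin k ] toℕ z ≡ 0
zero-of Fin.zero = Fin.zero , refl
zero-of (Fin.suc _) = Fin.zero , refl

nonempty : ∀ {k} → Fin k → 1 ≤ k
nonempty i = ℕP.≤-trans (s≤s z≤n) (FinP.toℕ<n i)

transpose-matchˡ : ∀ {k} (i j : Fin k) → Perm.transpose i j ⟨$⟩ʳ i ≡ j
transpose-matchˡ i j with i Fin.≟ i
... | yes _ = refl
... | no i≢i = ⊥-elim (i≢i refl)

⟨$⟩ʳ-injective : ∀ {k} (π : Permutation′ k) {i j} → π ⟨$⟩ʳ i ≡ π ⟨$⟩ʳ j → i ≡ j
⟨$⟩ʳ-injective π eq = trans (sym (Perm.inverseˡ π)) (trans (cong (π Perm.⟨$⟩ˡ_) eq) (Perm.inverseˡ π))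

module GapPermutation
  (l : List ℕ) (k : ℕ) (k<n : k < length l) (b : ℕ)
  (sorted : ∀ i → 1 ≤ i → suc i ≤ length l → nth l i ≤ nth l (suc i))
  (block : ∀ t → 2 ≤ t → t ≤ suc k → nth l t ≡ b)
  (first≢b : nth l 1 ≢ b)
  where

  n : ℕ
  n = length l

  β : ℚ
  β = ℕ→ℚ b

  gap : Point → Fin k → ℚ
  gap x s = x (suc (suc (toℕ s))) 1 - x (suc (toℕ s)) 1

  permutedGap : Permutation′ k → Point → Fin k → ℚ
  permutedGap σ x s = gap x (σ ⟨$⟩ʳ s)

  -- Column 1 is rebuilt from x₁₁ by adding up the gaps in the order given by σ.
  -- Row k+1 keeps its value, as the gaps keep their total.
  permutedColumn : Permutation′ k → Point → ℕ → ℚ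
  permutedColumn σ x (suc (suc r)) with suc r <? k
  ... | yes _ = x 1 1 +ℚ prefixSum (permutedGap σ x) (suc r)
  ... | no _ = x (suc (suc r)) 1
  permutedColumn σ x i = x i 1

  permuteGaps : Permutation′ k → Point → Point
  permuteGaps σ x i (suc zero) = permutedColumn σ x i
  permuteGaps σ x i j = x i j

  -- Split on the column first, so that ¬ Moved (i , j) reduces for every row i when j ≠ 1.
  Moved : Idx → Set
  Moved (_ , zero) = ⊥
  Moved (_ , suc (suc _)) = ⊥
  Moved (zero , suc zero) = ⊥
  Moved (suc zero , suc zero) = ⊥
  Moved (suc (suc r) , suc zero) = suc r < k

  diagonal-unmoved : ∀ i → ¬ Moved (i , i)
  diagonal-unmoved zero ()
  diagonal-unmoved (suc zero) ()
  diagonal-unmoved (suc (suc i)) ()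

  permuteGaps-fixes : ∀ σ x {i j} → ¬ Moved (i , j) → permuteGaps σ x i j ≡ x i j
  permuteGaps-fixes σ x {j = zero} _ = refl
  permuteGaps-fixes σ x {j = suc (suc _)} _ = refl
  permuteGaps-fixes σ x {zero} {suc zero} _ = refl
  permuteGaps-fixes σ x {suc zero} {suc zero} _ = refl
  permuteGaps-fixes σ x {suc (suc r)} {suc zero} unmoved with suc r <? k
  ... | yes moved = ⊥-elim (unmoved moved)
  ... | no _ = refl

  column-telescope : ∀ x {r} → r ≤ k → x 1 1 +ℚ prefixSum (gap x) r ≡ x (suc r) 1
  column-telescope x {zero} _ = ℚP.+-identityʳ (x 1 1)
  column-telescope x {suc r} r<k = begin
    x 1 1 +ℚ prefixSum (gap x) (suc r)
      ≡⟨ cong (x 1 1 +ℚ_) (prefixSum-suc (gap x) r<k) ⟩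
    x 1 1 +ℚ (prefixSum (gap x) r +ℚ gap x (fromℕ< r<k))
      ≡⟨ ℚP.+-assoc (x 1 1) _ _ ⟨
    (x 1 1 +ℚ prefixSum (gap x) r) +ℚ gap x (fromℕ< r<k)
      ≡⟨ cong₂ _+ℚ_ (column-telescope x (ℕP.<⇒≤ r<k))
                    (cong (λ t → x (suc (suc t)) 1 - x (suc t) 1) (FinP.toℕ-fromℕ< r<k)) ⟩
    x (suc r) 1 +ℚ (x (suc (suc r)) 1 - x (suc r) 1)
      ≡⟨ ℚP.+-comm (x (suc r) 1) _ ⟩
    (x (suc (suc r)) 1 - x (suc r) 1) +ℚ x (suc r) 1
      ≡⟨ ℚ-Group.//-rightDividesˡ (x (suc r) 1) (x (suc (suc r)) 1) ⟩
    x (suc (suc r)) 1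
      ∎
    where open ≡-Reasoning

  permutedGap-total : ∀ σ x → x 1 1 +ℚ prefixSum (permutedGap σ x) k ≡ x (suc k) 1
  permutedGap-total σ x = begin
    x 1 1 +ℚ prefixSum (permutedGap σ x) k  ≡⟨ cong (x 1 1 +ℚ_) (prefixSum-total (permutedGap σ x)) ⟩
    x 1 1 +ℚ ℚ-Sum.sum (permutedGap σ x)    ≡⟨ cong (x 1 1 +ℚ_) (ℚ-Sum.sum-permute (gap x) σ) ⟨
    x 1 1 +ℚ ℚ-Sum.sum (gap x)              ≡⟨ cong (x 1 1 +ℚ_) (prefixSum-total (gap x)) ⟨
    x 1 1 +ℚ prefixSum (gap x) k            ≡⟨ column-telescope x ℕP.≤-refl ⟩
    x (suc k) 1                             ∎
    where open ≡-Reasoning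

  permutedColumn-prefixSum : ∀ σ x {r} → r ≤ k →
                             permutedColumn σ x (suc r) ≡ x 1 1 +ℚ prefixSum (permutedGap σ x) r
  permutedColumn-prefixSum σ x {zero} _ = sym (ℚP.+-identityʳ (x 1 1))
  permutedColumn-prefixSum σ x {suc r} r<k with suc r <? k
  ... | yes _ = refl
  ... | no r≮k = subst (λ t → x (suc t) 1 ≡ x 1 1 +ℚ prefixSum (permutedGap σ x) t)
                   (ℕP.≤-antisym (ℕP.≮⇒≥ r≮k) r<k) (sym (permutedGap-total σ x))

  permuteGaps-top : ∀ σ x → permuteGaps σ x (suc k) 1 ≡ x (suc k) 1
  permuteGaps-top σ x = trans (permutedColumn-prefixSum σ x ℕP.≤-refl) (permutedGap-total σ x)

  gap-permuteGaps : ∀ σ x s → gap (permuteGaps σ x) s ≡ permutedGap σ x s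
  gap-permuteGaps σ x s = begin
    permutedColumn σ x (suc (suc (toℕ s))) - permutedColumn σ x (suc (toℕ s))
      ≡⟨ cong₂ _-_ (permutedColumn-prefixSum σ x s<k) (permutedColumn-prefixSum σ x (ℕP.<⇒≤ s<k)) ⟩
    (x 1 1 +ℚ P (suc (toℕ s))) - (x 1 1 +ℚ P (toℕ s))
      ≡⟨ cong (λ p → (x 1 1 +ℚ p) - (x 1 1 +ℚ P (toℕ s))) (prefixSum-suc w s<k) ⟩
    (x 1 1 +ℚ (P (toℕ s) +ℚ w (fromℕ< s<k))) - (x 1 1 +ℚ P (toℕ s))
      ≡⟨ cong (_- (x 1 1 +ℚ P (toℕ s))) (sym (ℚP.+-assoc (x 1 1) (P (toℕ s)) _)) ⟩
    ((x 1 1 +ℚ P (toℕ s)) +ℚ w (fromℕ< s<k)) - (x 1 1 +ℚ P (toℕ s))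
      ≡⟨ [p+q]-p≡q (x 1 1 +ℚ P (toℕ s)) (w (fromℕ< s<k)) ⟩
    w (fromℕ< s<k)
      ≡⟨ cong w (FinP.fromℕ<-toℕ s s<k) ⟩
    w s ∎
    where
    open ≡-Reasoning
    w : Fin k → ℚ
    w = permutedGap σ x
    P : ℕ → ℚ
    P = prefixSum w
    s<k : toℕ s < k
    s<k = FinP.toℕ<n s

  permuteGaps-∘ : ∀ σ τ x → permuteGaps σ (permuteGaps τ x) ≗₂ permuteGaps (σ ∘ₚ τ) x
  permuteGaps-∘ σ τ x i zero = refl
  permuteGaps-∘ σ τ x i (suc (suc j)) = refl
  permuteGaps-∘ σ τ x zero (suc zero) = refl
  permuteGaps-∘ σ τ x (suc zero) (suc zero) = refl
  permuteGaps-∘ σ τ x (suc (suc r)) (suc zero) with suc r <? k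
  ... | yes _ = cong (x 1 1 +ℚ_) (prefixSum-cong (λ s → gap-permuteGaps τ x (σ ⟨$⟩ʳ s)) (suc r))
  ... | no r≮k = permuteGaps-fixes τ x r≮k

  permuteGaps-id : ∀ σ → (∀ s → σ ⟨$⟩ʳ s ≡ s) → ∀ x → permuteGaps σ x ≗₂ x
  permuteGaps-id σ σ≗id x i zero = refl
  permuteGaps-id σ σ≗id x i (suc (suc j)) = refl
  permuteGaps-id σ σ≗id x zero (suc zero) = refl
  permuteGaps-id σ σ≗id x (suc zero) (suc zero) = refl
  permuteGaps-id σ σ≗id x (suc (suc r)) (suc zero) with suc r <? k
  ... | yes r<k = trans (cong (x 1 1 +ℚ_) (prefixSum-cong (λ s → cong (gap x) (σ≗id s)) (suc r)))
                        (column-telescope x (ℕP.<⇒≤ r<k))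
  ... | no _ = refl

  permuteGaps-cancel : ∀ σ τ → (∀ s → (σ ∘ₚ τ) ⟨$⟩ʳ s ≡ s) →
                       ∀ x → permuteGaps σ (permuteGaps τ x) ≗₂ x
  permuteGaps-cancel σ τ στ≗id x i j =
    trans (permuteGaps-∘ σ τ x i j) (permuteGaps-id (σ ∘ₚ τ) στ≗id x i j)

  chainEdge : Fin k → Idx × Idx
  chainEdge s = ((suc (toℕ s) , 1) , (suc (suc (toℕ s)) , 1))

  rowEdge : ℕ → Idx × Idx
  rowEdge t = ((t , 1) , (t , 2))

  rungEdge : Fin k → Idx × Idx
  rungEdge r = rowEdge (suc (suc (toℕ r)))

  topRung : Idx × Idx
  topRung = rowEdge (suc k)

  chainEdge-IsEdge : ∀ s → IsEdge n (chainEdge s)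
  chainEdge-IsEdge s =
    (s≤s z≤n , s≤s z≤n , ℕP.≤-trans (FinP.toℕ<n s) (ℕP.<⇒≤ k<n)) ,
    (s≤s z≤n , s≤s z≤n , ℕP.≤-trans (s≤s (FinP.toℕ<n s)) k<n) , inj₁ (refl , refl)

  rowEdge-IsEdge : ∀ {t} → 2 ≤ t → t ≤ n → IsEdge n (rowEdge t)
  rowEdge-IsEdge 2≤t t≤n =
    (s≤s z≤n , ℕP.≤-trans (s≤s z≤n) 2≤t , t≤n) , (s≤s z≤n , 2≤t , t≤n) , inj₂ (refl , refl)

  topRung-IsEdge : 1 ≤ k → IsEdge n topRung
  topRung-IsEdge 1≤k = rowEdge-IsEdge (s≤s 1≤k) k<n

  permuteGaps-chain-tight⁺ : ∀ σ x s → TightAt x (chainEdge (σ ⟨$⟩ʳ s)) →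
                             TightAt (permuteGaps σ x) (chainEdge s)
  permuteGaps-chain-tight⁺ σ x s t = q-p≡0⇒p≡q (trans (gap-permuteGaps σ x s) (p≡q⇒q-p≡0 t))

  permuteGaps-chain-tight⁻ : ∀ σ x s → TightAt (permuteGaps σ x) (chainEdge s) →
                             TightAt x (chainEdge (σ ⟨$⟩ʳ s))
  permuteGaps-chain-tight⁻ σ x s t = q-p≡0⇒p≡q (trans (sym (gap-permuteGaps σ x s)) (p≡q⇒q-p≡0 t))

  permuteGaps-chain-holds : ∀ σ {x} → InGT l x → ∀ s → Holds (permuteGaps σ x) (chainEdge s)
  permuteGaps-chain-holds σ {x} x∈GT s = 0≤q-p⇒p≤q (subst (0ℚ ≤ℚ_) (sym (gap-permuteGaps σ x s))
    (p≤q⇒0≤q-p (proj₂ x∈GT (chainEdge (σ ⟨$⟩ʳ s)) (chainEdge-IsEdge _))))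

  data EdgeKind : Idx × Idx → Set where
    chain : ∀ s → EdgeKind (chainEdge s)
    rung : ∀ r → EdgeKind (rungEdge r)
    still : ∀ {p q} → ¬ Moved p → ¬ Moved q → EdgeKind (p , q)

  vertical-kind : ∀ i j → ValidIdx n (i , j) → EdgeKind ((i , j) , (suc i , j))
  vertical-kind i zero (() , _)
  vertical-kind i (suc (suc j)) _ = still (λ ()) (λ ())
  vertical-kind zero (suc zero) _ = still (λ ()) (λ ())
  vertical-kind (suc s) (suc zero) _ with s <? k
  ... | yes s<k = subst (λ t → EdgeKind ((suc t , 1) , (suc (suc t) , 1))) (FinP.toℕ-fromℕ< s<k)
                    (chain (fromℕ< s<k))
  ... | no s≮k = still (lower-unmoved s s≮k) (λ 1+s<k → s≮k (ℕP.<-trans (ℕP.n<1+n s) 1+s<k))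
    where
    lower-unmoved : ∀ s → ¬ s < k → ¬ Moved (suc s , 1)
    lower-unmoved zero _ ()
    lower-unmoved (suc s) s≮k = s≮k

  horizontal-kind : ∀ i j → ValidIdx n (i , j) → EdgeKind ((i , j) , (i , suc j))
  horizontal-kind i zero (() , _)
  horizontal-kind i (suc (suc j)) _ = still (λ ()) (λ ())
  horizontal-kind zero (suc zero) _ = still (λ ()) (λ ())
  horizontal-kind (suc zero) (suc zero) _ = still (λ ()) (λ ())
  horizontal-kind (suc (suc r)) (suc zero) _ with r <? k
  ... | yes r<k = subst (λ t → EdgeKind ((suc (suc t) , 1) , (suc (suc t) , 2))) (FinP.toℕ-fromℕ< r<k)
                    (rung (fromℕ< r<k))
  ... | no r≮k = still (λ 1+r<k → r≮k (ℕP.<-trans (ℕP.n<1+n r) 1+r<k)) (λ ())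

  classify : ∀ e → IsEdge n e → EdgeKind e
  classify ((i , j) , _) (p , _ , inj₁ (refl , refl)) = vertical-kind i j p
  classify ((i , j) , _) (p , _ , inj₂ (refl , refl)) = horizontal-kind i j p

  -- Pulling back x_{r+2,1} = x_{r+2,2}: every gap after the r-th closes and the column
  -- reaches b in row k+1.  Entries s ≤ r are padded with topRung, which is in the list anyway.
  chainAbove : Permutation′ k → Fin k → Fin k → Idx × Idx
  chainAbove σ r s with toℕ r <? toℕ s
  ... | yes _ = chainEdge (σ ⟨$⟩ʳ s)
  ... | no _ = topRung

  rungPullback : Permutation′ k → Fin k → List (Idx × Idx)
  rungPullback σ r = tabulate (chainAbove σ r) ++ topRung ∷ []

  rungPullback-IsEdge : ∀ σ r → All (IsEdge n) (rungPullback σ r)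
  rungPullback-IsEdge σ r = AllP.++⁺ (AllP.tabulate⁺ chainAbove-IsEdge) (topRung-IsEdge (nonempty r) ∷ [])
    where
    chainAbove-IsEdge : ∀ s → IsEdge n (chainAbove σ r s)
    chainAbove-IsEdge s with toℕ r <? toℕ s
    ... | yes _ = chainEdge-IsEdge _
    ... | no _ = topRung-IsEdge (nonempty r)

  ChainsAboveTight : Permutation′ k → Fin k → Point → Set
  ChainsAboveTight σ r x = ∀ s → toℕ r < toℕ s → TightAt x (chainEdge (σ ⟨$⟩ʳ s))

  rungPullback-tight⁺ : ∀ σ r {x} → ChainsAboveTight σ r x → TightAt x topRung →
                        All (TightAt x) (rungPullback σ r)
  rungPullback-tight⁺ σ r {x} above top = AllP.++⁺ (AllP.tabulate⁺ chainAbove-tight) (top ∷ [])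
    where
    chainAbove-tight : ∀ s → TightAt x (chainAbove σ r s)
    chainAbove-tight s with toℕ r <? toℕ s
    ... | yes r<s = above s r<s
    ... | no _ = top

  rungPullback-tight⁻ : ∀ σ r {x} → All (TightAt x) (rungPullback σ r) →
                        ChainsAboveTight σ r x × TightAt x topRung
  rungPullback-tight⁻ σ r {x} ts with AllP.++⁻ (tabulate (chainAbove σ r)) ts
  ... | chains , (top ∷ []) = (λ s r<s → chainAbove-tight s r<s (AllP.tabulate⁻ chains s)) , top
    where
    chainAbove-tight : ∀ s → toℕ r < toℕ s → TightAt x (chainAbove σ r s) →
                       TightAt x (chainEdge (σ ⟨$⟩ʳ s))
    chainAbove-tight s r<s t with toℕ r <? toℕ s
    ... | yes _ = t
    ... | no r≮s = ⊥-elim (r≮s r<s)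

  edgePullback : Permutation′ k → ∀ e → IsEdge n e → EdgeKind e → FaceRep n
  edgePullback σ _ _ (chain s) = chainEdge (σ ⟨$⟩ʳ s) ∷ [] , chainEdge-IsEdge _ ∷ []
  edgePullback σ _ _ (rung r) = rungPullback σ r , rungPullback-IsEdge σ r
  edgePullback σ e e∈E (still _ _) = e ∷ [] , e∈E ∷ []

  facePullback : Permutation′ k → FaceRep n → FaceRep n
  facePullback σ ([] , []) = [] , []
  facePullback σ ((e ∷ S) , (e∈E ∷ S⊆E)) =
    edgePullback σ e e∈E (classify e e∈E) ∩ᶠ facePullback σ (S , S⊆E)

  module _ {x : Point} (x∈GT : InGT l x) where

    block-entry : ∀ {t} → 2 ≤ t → t ≤ suc k → x t 2 ≡ β
    block-entry {t} 2≤t t≤1+k =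
      trans (squeeze {l} x∈GT (s≤s z≤n) 2≤t (ℕP.≤-trans t≤1+k k<n) (trans λ₂≡b (sym (block t 2≤t t≤1+k))))
            (cong ℕ→ℚ λ₂≡b)
      where
      λ₂≡b : nth l 2 ≡ b
      λ₂≡b = block 2 ℕP.≤-refl (ℕP.≤-trans 2≤t t≤1+k)

  module _ (σ : Permutation′ k) {x : Point} (x∈GT : InGT l x) where

    column : ℕ → ℚ
    column m = permutedColumn σ x (suc m)

    column-step : ∀ m → m < k → column m ≤ℚ column (suc m)
    column-step m m<k = subst (λ t → column t ≤ℚ column (suc t)) (FinP.toℕ-fromℕ< m<k)
      (permuteGaps-chain-holds σ x∈GT (fromℕ< m<k))

    open MonotoneSequence column k column-step

    column-top≤β : 1 ≤ k → column k ≤ℚ β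
    column-top≤β 1≤k = subst₂ _≤ℚ_ (sym (permuteGaps-top σ x)) (block-entry x∈GT (s≤s 1≤k) ℕP.≤-refl)
      (proj₂ x∈GT topRung (topRung-IsEdge 1≤k))

    rung-block-entry : ∀ r → x (suc (suc (toℕ r))) 2 ≡ β
    rung-block-entry r = block-entry x∈GT (s≤s (s≤s z≤n)) (s≤s (FinP.toℕ<n r))

    top-block-entry : ∀ r → x (suc k) 2 ≡ β
    top-block-entry r = block-entry x∈GT (s≤s (nonempty r)) ℕP.≤-refl

    rung-tight⁺ : ∀ r → TightAt (permuteGaps σ x) (rungEdge r) → All (TightAt x) (rungPullback σ r)
    rung-tight⁺ r t = rungPullback-tight⁺ σ r above top
      where
      flat×reaches : FlatFrom (suc (toℕ r)) × column k ≡ β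
      flat×reaches = reachesBound⇒flat (FinP.toℕ<n r) (column-top≤β (nonempty r))
                                        (trans t (rung-block-entry r))
      above : ChainsAboveTight σ r x
      above s r<s = permuteGaps-chain-tight⁻ σ x s (proj₁ flat×reaches (toℕ s) r<s (FinP.toℕ<n s))
      top : TightAt x topRung
      top = trans (sym (permuteGaps-top σ x)) (trans (proj₂ flat×reaches) (sym (top-block-entry r)))

    rung-tight⁻ : ∀ r → All (TightAt x) (rungPullback σ r) → TightAt (permuteGaps σ x) (rungEdge r)
    rung-tight⁻ r ts = trans (flat⇒reachesBound (FinP.toℕ<n r) flat reaches) (sym (rung-block-entry r))
      where
      above×top : ChainsAboveTight σ r x × TightAt x topRung
      above×top = rungPullback-tight⁻ σ r ts
      flat : FlatFrom (suc (toℕ r))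
      flat m r<m m<k = subst (λ t → column t ≡ column (suc t)) (FinP.toℕ-fromℕ< m<k)
        (permuteGaps-chain-tight⁺ σ x (fromℕ< m<k)
          (proj₁ above×top (fromℕ< m<k) (subst (toℕ r <_) (sym (FinP.toℕ-fromℕ< m<k)) r<m)))
      reaches : column k ≡ β
      reaches = trans (permuteGaps-top σ x) (trans (proj₂ above×top) (top-block-entry r))

    edgePullback-tight⁺ : ∀ e e∈E (kind : EdgeKind e) →
                          TightAt (permuteGaps σ x) e → Tight (edgePullback σ e e∈E kind) x
    edgePullback-tight⁺ _ _ (chain s) t = permuteGaps-chain-tight⁻ σ x s t ∷ []
    edgePullback-tight⁺ _ _ (rung r) t = rung-tight⁺ r t
    edgePullback-tight⁺ _ _ (still p∉ q∉) t =
      trans (sym (permuteGaps-fixes σ x p∉)) (trans t (permuteGaps-fixes σ x q∉)) ∷ []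

    edgePullback-tight⁻ : ∀ e e∈E (kind : EdgeKind e) →
                          Tight (edgePullback σ e e∈E kind) x → TightAt (permuteGaps σ x) e
    edgePullback-tight⁻ _ _ (chain s) (t ∷ []) = permuteGaps-chain-tight⁺ σ x s t
    edgePullback-tight⁻ _ _ (rung r) ts = rung-tight⁻ r ts
    edgePullback-tight⁻ _ _ (still p∉ q∉) (t ∷ []) =
      trans (permuteGaps-fixes σ x p∉) (trans t (sym (permuteGaps-fixes σ x q∉)))

    permuteGaps-holds : ∀ e → IsEdge n e → EdgeKind e → Holds (permuteGaps σ x) e
    permuteGaps-holds _ _ (chain s) = permuteGaps-chain-holds σ x∈GT s
    permuteGaps-holds _ _ (rung r) = ℚP.≤-trans (mono (FinP.toℕ<n r) ℕP.≤-refl)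
      (subst (column k ≤ℚ_) (sym (rung-block-entry r)) (column-top≤β (nonempty r)))
    permuteGaps-holds e e∈E (still p∉ q∉) =
      subst₂ _≤ℚ_ (sym (permuteGaps-fixes σ x p∉)) (sym (permuteGaps-fixes σ x q∉)) (proj₂ x∈GT e e∈E)

    permuteGaps-InGT : InGT l (permuteGaps σ x)
    permuteGaps-InGT =
      (λ i 1≤i i≤n → trans (permuteGaps-fixes σ x (diagonal-unmoved i)) (proj₁ x∈GT i 1≤i i≤n)) ,
      (λ e e∈E → permuteGaps-holds e e∈E (classify e e∈E))

    facePullback-tight⁺ : ∀ F → Tight F (permuteGaps σ x) → Tight (facePullback σ F) x
    facePullback-tight⁺ ([] , []) [] = []
    facePullback-tight⁺ ((e ∷ S) , (e∈E ∷ S⊆E)) (t ∷ ts) =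
      ∩ᶠ-tight⁺ (edgePullback σ e e∈E (classify e e∈E)) (facePullback σ (S , S⊆E))
        (edgePullback-tight⁺ e e∈E (classify e e∈E) t) (facePullback-tight⁺ (S , S⊆E) ts)

    facePullback-tight⁻ : ∀ F → Tight (facePullback σ F) x → Tight F (permuteGaps σ x)
    facePullback-tight⁻ ([] , []) [] = []
    facePullback-tight⁻ ((e ∷ S) , (e∈E ∷ S⊆E)) ts =
      edgePullback-tight⁻ e e∈E (classify e e∈E) (proj₁ split) ∷ facePullback-tight⁻ (S , S⊆E) (proj₂ split)
      where
      split : Tight (edgePullback σ e e∈E (classify e e∈E)) x × Tight (facePullback σ (S , S⊆E)) x
      split = ∩ᶠ-tight⁻ (edgePullback σ e e∈E (classify e e∈E)) (facePullback σ (S , S⊆E)) ts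

  gapSymmetry : Permutation′ k → GTSymmetry l
  gapSymmetry σ = record
    { act = permuteGaps σ
    ; pullback = facePullback σ
    ; act-InGT = permuteGaps-InGT σ
    ; pullback-tight⁺ = facePullback-tight⁺ σ
    ; pullback-tight⁻ = facePullback-tight⁻ σ
    }

  gapAut : Permutation′ k → Aut l
  gapAut σ = symmetryAut (gapSymmetry σ) (gapSymmetry (Perm.flip σ))
    (permuteGaps-cancel σ (Perm.flip σ) (λ _ → Perm.inverseˡ σ))
    (permuteGaps-cancel (Perm.flip σ) σ (λ _ → Perm.inverseʳ σ))

  gapAut-hom : ∀ σ τ F → Same l (fun (gapAut (σ ∘ₚ τ)) F) (fun (gapAut τ) (fun (gapAut σ) F))
  gapAut-hom σ τ = pullback-∘ (gapSymmetry σ) (gapSymmetry τ) (gapSymmetry (σ ∘ₚ τ)) (permuteGaps-∘ σ τ)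

  basePoint : Point
  basePoint i _ = ℕ→ℚ (nth l i)

  basePoint-InGT : InGT l basePoint
  basePoint-InGT = (λ _ _ _ → refl) , holds
    where
    holds : ∀ e → IsEdge n e → Holds basePoint e
    holds _ ((1≤j , j≤i , _) , (_ , _ , 1+i≤n) , inj₁ (refl , refl)) =
      ℕ→ℚ-mono-≤ (sorted _ (ℕP.≤-trans 1≤j j≤i) 1+i≤n)
    holds _ (_ , _ , inj₂ (refl , refl)) = ℚP.≤-refl

  basePoint-chain-tight : ∀ s → toℕ s ≢ 0 → TightAt basePoint (chainEdge s)
  basePoint-chain-tight s s≢0 with toℕ s | FinP.toℕ<n s
  ... | zero | _ = ⊥-elim (s≢0 refl)
  ... | suc m | 1+m<k = cong ℕ→ℚ (trans (block (2 + m) (s≤s (s≤s z≤n)) (s≤s (ℕP.<⇒≤ 1+m<k)))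
                                         (sym (block (3 + m) (s≤s (s≤s z≤n)) (s≤s 1+m<k))))

  basePoint-chain-open : ∀ s → toℕ s ≡ 0 → ¬ TightAt basePoint (chainEdge s)
  basePoint-chain-open s s≡0 t = first≢b (trans (ℕ→ℚ-injective t′) (block 2 ℕP.≤-refl (s≤s (nonempty s))))
    where
    t′ : ℕ→ℚ (nth l 1) ≡ ℕ→ℚ (nth l 2)
    t′ = subst (λ m → ℕ→ℚ (nth l (suc m)) ≡ ℕ→ℚ (nth l (suc (suc m)))) s≡0 t

  -- In basePoint only the first gap is open; transposing it to position i gives
  -- a pattern of GT_λ whose only open chain edge is the i-th one.
  module _ (i : Fin k) where

    private
      z : Fin k
      z = proj₁ (zero-of i)
      ρ : Permutation′ k
      ρ = Perm.transpose i z

    witness : Point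
    witness = permuteGaps ρ basePoint

    witness-InGT : InGT l witness
    witness-InGT = permuteGaps-InGT ρ basePoint-InGT

    witness-tight : ∀ s → s ≢ i → TightAt witness (chainEdge s)
    witness-tight s s≢i = permuteGaps-chain-tight⁺ ρ basePoint s (basePoint-chain-tight (ρ ⟨$⟩ʳ s) ρs≢0)
      where
      ρs≢0 : toℕ (ρ ⟨$⟩ʳ s) ≢ 0
      ρs≢0 ρs≡0 = s≢i (⟨$⟩ʳ-injective ρ
        (trans (FinP.toℕ-injective (trans ρs≡0 (sym (proj₂ (zero-of i))))) (sym (transpose-matchˡ i z))))

    witness-open : ¬ TightAt witness (chainEdge i)
    witness-open t = basePoint-chain-open z (proj₂ (zero-of i))
      (subst (λ s → TightAt basePoint (chainEdge s)) (transpose-matchˡ i z)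
        (permuteGaps-chain-tight⁻ ρ basePoint i t))

  gapAut-faithful : ∀ σ → (∀ F → Same l (fun (gapAut σ) F) F) → ∀ i → σ ⟨$⟩ʳ i ≡ i
  gapAut-faithful σ fixes i with σ ⟨$⟩ʳ i Fin.≟ i
  ... | yes σi≡i = σi≡i
  ... | no σi≢i = ⊥-elim (witness-open i (All.head (proj₁ (fixes Fᵢ) (witness i) (witness-InGT i) on-pullback)))
    where
    Fᵢ : FaceRep n
    Fᵢ = chainEdge i ∷ [] , chainEdge-IsEdge i ∷ []
    on-pullback : Tight (facePullback σ Fᵢ) (witness i)
    on-pullback = facePullback-tight⁺ σ (witness-InGT i) Fᵢ
      (permuteGaps-chain-tight⁺ σ (witness i) i (witness-tight i (σ ⟨$⟩ʳ i) σi≢i) ∷ [])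

  containsSym : ContainsSym l k
  containsSym = gapAut , gapAut-hom , gapAut-faithful

-- (i , j) ↦ (N+1−j , N+1−i) reflects the triangle of indices in its anti-diagonal,
-- exchanging vertical and horizontal edges and reversing their direction; composed
-- with the order-reversing x ↦ c − x it therefore preserves every defining inequality.
module Duality (N c : ℕ) where

  flipIdx : Idx → Idx
  flipIdx (i , j) = suc N ∸ j , suc N ∸ i

  flipEdge : Idx × Idx → Idx × Idx
  flipEdge (p , q) = flipIdx q , flipIdx p

  flipPoint : Point → Point
  flipPoint x i j = ℕ→ℚ c - x (suc N ∸ j) (suc N ∸ i)

  flipIdx-valid : ∀ {i j} → ValidIdx N (i , j) → ValidIdx N (flipIdx (i , j))
  flipIdx-valid {i} {suc j} (_ , j≤i , i≤N) =
    subst (1 ≤_) (sym (ℕP.+-∸-assoc 1 i≤N)) (s≤s z≤n) , ℕP.∸-monoʳ-≤ (suc N) j≤i , ℕP.m∸n≤m N j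

  flipPoint-involutive : ∀ x → AgreeOn N (flipPoint (flipPoint x)) x
  flipPoint-involutive x i j (_ , j≤i , i≤N) =
    trans (p-[p-q]≡q (ℕ→ℚ c) _) (cong₂ x (ℕP.m∸[m∸n]≡n (ℕP.m≤n⇒m≤1+n i≤N))
                                              (ℕP.m∸[m∸n]≡n (ℕP.m≤n⇒m≤1+n (ℕP.≤-trans j≤i i≤N))))

  flipEdge-IsEdge : ∀ {e} → IsEdge N e → IsEdge N (flipEdge e)
  flipEdge-IsEdge {(i , j) , _} (p , q , inj₁ (refl , refl)) =
    flipIdx-valid q , flipIdx-valid p , inj₂ (refl , sym (ℕP.+-∸-assoc 1 (proj₂ (proj₂ p))))
  flipEdge-IsEdge {(i , j) , _} (p , q , inj₂ (refl , refl)) =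
    flipIdx-valid q , flipIdx-valid p ,
    inj₁ (sym (ℕP.+-∸-assoc 1 (ℕP.≤-trans (proj₁ (proj₂ p)) (proj₂ (proj₂ p)))) , refl)

  flipPoint-tight⁺ : ∀ x e → TightAt x (flipEdge e) → TightAt (flipPoint x) e
  flipPoint-tight⁺ x _ t = cong (λ q → ℕ→ℚ c - q) (sym t)

  flipPoint-tight⁻ : ∀ x e → TightAt (flipPoint x) e → TightAt x (flipEdge e)
  flipPoint-tight⁻ x _ t = sym (p-q≡p-r⇒q≡r (ℕ→ℚ c) t)

  flipPoint-holds : ∀ x e → Holds x (flipEdge e) → Holds (flipPoint x) e
  flipPoint-holds x _ = q≤r⇒p-r≤p-q (ℕ→ℚ c)

  Dual : List ℕ → List ℕ → Set
  Dual l l′ = ∀ i → 1 ≤ i → i ≤ N → nth l′ i + nth l (suc N ∸ i) ≡ c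

  Dual-sym : ∀ {l l′} → Dual l l′ → Dual l′ l
  Dual-sym {l} {l′} dual i 1≤i i≤N = begin
    nth l i + nth l′ (suc N ∸ i)
      ≡⟨ ℕP.+-comm (nth l i) _ ⟩
    nth l′ (suc N ∸ i) + nth l i
      ≡⟨ cong (λ t → nth l′ (suc N ∸ i) + nth l t) i≡ ⟨
    nth l′ (suc N ∸ i) + nth l (suc N ∸ (suc N ∸ i))
      ≡⟨ dual (suc N ∸ i) (proj₁ v) (proj₂ (proj₂ v)) ⟩
    c
      ∎
    where
    open ≡-Reasoning
    i≡ : suc N ∸ (suc N ∸ i) ≡ i
    i≡ = ℕP.m∸[m∸n]≡n (ℕP.m≤n⇒m≤1+n i≤N)
    v : ValidIdx N (flipIdx (i , i))
    v = flipIdx-valid {i} {i} (1≤i , ℕP.≤-refl , i≤N)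

  flipPoint-InGT : ∀ {l l′ x} → length l ≡ N → length l′ ≡ N → Dual l l′ →
                   InGT l x → InGT l′ (flipPoint x)
  flipPoint-InGT {l} {l′} {x} ∣l∣≡N ∣l′∣≡N dual (diagonal , holds) = diagonal′ , holds′
    where
    diagonal′ : ∀ i → 1 ≤ i → i ≤ length l′ → flipPoint x i i ≡ ℕ→ℚ (nth l′ i)
    diagonal′ i 1≤i i≤n′ = begin
      ℕ→ℚ c - x i′ i′
        ≡⟨ cong (λ q → ℕ→ℚ c - q) x-diagonal ⟩
      ℕ→ℚ c - ℕ→ℚ (nth l i′)
        ≡⟨ cong (λ t → ℕ→ℚ t - ℕ→ℚ (nth l i′)) (dual i 1≤i i≤N) ⟨
      ℕ→ℚ (nth l′ i + nth l i′) - ℕ→ℚ (nth l i′)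
        ≡⟨ cong (_- ℕ→ℚ (nth l i′)) (ℕ→ℚ-homo-+ (nth l′ i) (nth l i′)) ⟩
      (ℕ→ℚ (nth l′ i) +ℚ ℕ→ℚ (nth l i′)) - ℕ→ℚ (nth l i′)
        ≡⟨ [p+q]-q≡p _ _ ⟩
      ℕ→ℚ (nth l′ i)
        ∎
      where
      open ≡-Reasoning
      i≤N : i ≤ N
      i≤N = subst (i ≤_) ∣l′∣≡N i≤n′
      i′ : ℕ
      i′ = suc N ∸ i
      v : ValidIdx N (i′ , i′)
      v = flipIdx-valid {i} {i} (1≤i , ℕP.≤-refl , i≤N)
      x-diagonal : x i′ i′ ≡ ℕ→ℚ (nth l i′)
      x-diagonal = diagonal i′ (proj₁ v) (subst (i′ ≤_) (sym ∣l∣≡N) (proj₂ (proj₂ v)))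
    holds′ : ∀ e → IsEdge (length l′) e → Holds (flipPoint x) e
    holds′ e e∈E = flipPoint-holds x e
      (holds (flipEdge e) (subst (λ m → IsEdge m (flipEdge e)) (sym ∣l∣≡N)
        (flipEdge-IsEdge (subst (λ m → IsEdge m e) ∣l′∣≡N e∈E))))

  flipFace : ∀ {n n′} → n ≡ N → n′ ≡ N → FaceRep n → FaceRep n′
  flipFace refl refl (S , S⊆E) = map flipEdge S , AllP.map⁺ (All.map flipEdge-IsEdge S⊆E)

  flipFace-tight⁺ : ∀ {n n′} (e : n ≡ N) (e′ : n′ ≡ N) F {y} →
                    Tight F (flipPoint y) → Tight (flipFace e e′ F) y
  flipFace-tight⁺ refl refl _ {y} t = AllP.map⁺ (All.map (λ {e} → flipPoint-tight⁻ y e) t)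

  flipFace-tight⁻ : ∀ {n n′} (e : n ≡ N) (e′ : n′ ≡ N) F {y} →
                    Tight (flipFace e e′ F) y → Tight F (flipPoint y)
  flipFace-tight⁻ refl refl _ {y} t = All.map (λ {e} → flipPoint-tight⁺ y e) (AllP.map⁻ t)

  flipFace-mono : ∀ {l l′} (∣l∣≡N : length l ≡ N) (∣l′∣≡N : length l′ ≡ N) → Dual l l′ →
                  ∀ F G → Sub l′ F G → Sub l (flipFace ∣l′∣≡N ∣l∣≡N F) (flipFace ∣l′∣≡N ∣l∣≡N G)
  flipFace-mono {l} {l′} ∣l∣≡N ∣l′∣≡N dual F G F⊆G y y∈GT =
    flipFace-tight⁺ ∣l′∣≡N ∣l∣≡N G
    ∘′ F⊆G (flipPoint y) (flipPoint-InGT {l} {l′} ∣l∣≡N ∣l′∣≡N dual y∈GT)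
    ∘′ flipFace-tight⁻ ∣l′∣≡N ∣l∣≡N F

  flipFace-involutive : ∀ {l n′} (∣l∣≡N : length l ≡ N) (n′≡N : n′ ≡ N) F →
                        Same l (flipFace n′≡N ∣l∣≡N (flipFace ∣l∣≡N n′≡N F)) F
  flipFace-involutive {l} ∣l∣≡N n′≡N F = to , from
    where
    involutive : ∀ x → AgreeOn (length l) (flipPoint (flipPoint x)) x
    involutive x = subst (λ m → AgreeOn m (flipPoint (flipPoint x)) x) (sym ∣l∣≡N) (flipPoint-involutive x)
    to : Sub l (flipFace n′≡N ∣l∣≡N (flipFace ∣l∣≡N n′≡N F)) F
    to x _ = Tight-resp (involutive x) F
           ∘′ flipFace-tight⁻ ∣l∣≡N n′≡N F
           ∘′ flipFace-tight⁻ n′≡N ∣l∣≡N (flipFace ∣l∣≡N n′≡N F)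
    from : Sub l F (flipFace n′≡N ∣l∣≡N (flipFace ∣l∣≡N n′≡N F))
    from x _ = flipFace-tight⁺ n′≡N ∣l∣≡N (flipFace ∣l∣≡N n′≡N F)
             ∘′ flipFace-tight⁺ ∣l∣≡N n′≡N F
             ∘′ Tight-resp (λ i j v → sym (involutive x i j v)) F

  dualFaceIso : ∀ {l l′} → length l ≡ N → length l′ ≡ N → Dual l l′ → FaceIso l l′
  dualFaceIso {l} {l′} ∣l∣≡N ∣l′∣≡N dual = record
    { to = flipFace ∣l∣≡N ∣l′∣≡N
    ; from = flipFace ∣l′∣≡N ∣l∣≡N
    ; to-mono = flipFace-mono {l′} {l} ∣l′∣≡N ∣l∣≡N (Dual-sym {l} {l′} dual)
    ; from-mono = flipFace-mono {l} {l′} ∣l∣≡N ∣l′∣≡N dual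
    ; from-to = flipFace-involutive {l} ∣l∣≡N ∣l′∣≡N
    ; to-from = flipFace-involutive {l′} ∣l′∣≡N ∣l∣≡N
    }

nth-mono : ∀ {L} → AllPairs _≤_ L → ∀ i → 1 ≤ i → suc i ≤ length L → nth L i ≤ nth L (suc i)
nth-mono ((x≤y ∷ _) ∷ _) (suc zero) _ (s≤s (s≤s _)) = x≤y
nth-mono (_ ∷ L↗) (suc (suc i)) _ (s≤s i<n) = nth-mono L↗ (suc i) (s≤s z≤n) i<n

nth-replicate-++ : ∀ k (c : ℕ) R {t} → t < k → nth (replicate k c ++ R) (suc t) ≡ c
nth-replicate-++ (suc k) c R {zero} _ = refl
nth-replicate-++ (suc k) c R {suc t} (s≤s t<k) = nth-replicate-++ k c R t<k

nth-++ˡ : ∀ A B {i} → 1 ≤ i → i ≤ length A → nth (A ++ B) i ≡ nth A i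
nth-++ˡ (x ∷ A) B {suc zero} _ _ = refl
nth-++ˡ (x ∷ A) B {suc (suc i)} _ (s≤s i<∣A∣) = nth-++ˡ A B (s≤s z≤n) i<∣A∣

nth-∷ʳ-last : ∀ A (x : ℕ) → nth (A ++ x ∷ []) (suc (length A)) ≡ x
nth-∷ʳ-last [] x = refl
nth-∷ʳ-last (y ∷ A) x = nth-∷ʳ-last A x

nth-map : ∀ f L {i} → 1 ≤ i → i ≤ length L → nth (map f L) i ≡ f (nth L i)
nth-map f (x ∷ L) {suc zero} _ _ = refl
nth-map f (x ∷ L) {suc (suc i)} _ (s≤s i<n) = nth-map f L (s≤s z≤n) i<n

nth-≤ : ∀ {B} L → All (_≤ B) L → ∀ i → nth L i ≤ B
nth-≤ [] _ i = z≤n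
nth-≤ (x ∷ L) _ zero = z≤n
nth-≤ (x ∷ L) (x≤B ∷ _) (suc zero) = x≤B
nth-≤ (x ∷ L) (_ ∷ L≤B) (suc (suc i)) = nth-≤ L L≤B (suc i)

nth-reverse : ∀ L {i} → 1 ≤ i → i ≤ length L → nth (reverse L) i ≡ nth L (suc (length L) ∸ i)
nth-reverse (x ∷ L) {suc i} _ i≤∣L∣ rewrite ListP.unfold-reverse x L with ℕP.m≤n⇒m<n∨m≡n i≤∣L∣
... | inj₁ (s≤s i<∣L∣) = begin
  nth (reverse L ++ x ∷ []) (suc i)
    ≡⟨ nth-++ˡ (reverse L) _ (s≤s z≤n) (subst (suc i ≤_) (sym (ListP.length-reverse L)) i<∣L∣) ⟩
  nth (reverse L) (suc i)
    ≡⟨ nth-reverse L (s≤s z≤n) i<∣L∣ ⟩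
  nth L (length L ∸ i)
    ≡⟨ cong (nth L) (ℕP.+-∸-assoc 1 i<∣L∣) ⟩
  nth (x ∷ L) (suc (suc (length L ∸ suc i)))
    ≡⟨ cong (nth (x ∷ L) ∘ suc) (ℕP.+-∸-assoc 1 i<∣L∣) ⟨
  nth (x ∷ L) (suc (length L ∸ i))
    ≡⟨ cong (nth (x ∷ L)) (ℕP.+-∸-assoc 1 (ℕP.<⇒≤ i<∣L∣)) ⟨
  nth (x ∷ L) (suc (length L) ∸ i)
    ∎
  where open ≡-Reasoning
... | inj₂ refl = begin
  nth (reverse L ++ x ∷ []) (suc (length L))
    ≡⟨ cong (nth (reverse L ++ x ∷ []) ∘ suc) (ListP.length-reverse L) ⟨
  nth (reverse L ++ x ∷ []) (suc (length (reverse L)))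
    ≡⟨ nth-∷ʳ-last (reverse L) x ⟩
  x
    ≡⟨ cong (nth (x ∷ L)) (ℕP.m+n∸n≡m 1 (length L)) ⟨
  nth (x ∷ L) (suc (length L) ∸ length L)
    ∎
  where open ≡-Reasoning

replicate-sorted : ∀ a (c : ℕ) → AllPairs _≤_ (replicate a c)
replicate-sorted zero c = []
replicate-sorted (suc a) c = AllP.replicate⁺ a ℕP.≤-refl ∷ replicate-sorted a c

entries-lower : ∀ c as → All (c ≤_) (entries c as)
entries-lower c [] = []
entries-lower c (a ∷ as) =
  AllP.++⁺ (AllP.replicate⁺ a ℕP.≤-refl) (All.map (ℕP.≤-trans (ℕP.n≤1+n c)) (entries-lower (suc c) as))

entries-upper : ∀ c as → All (_≤ c + length as) (entries c as)
entries-upper c [] = []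
entries-upper c (a ∷ as) = AllP.++⁺ (AllP.replicate⁺ a (ℕP.m≤m+n c _))
  (All.map (λ {v} v≤ → subst (v ≤_) (sym (ℕP.+-suc c (length as))) v≤) (entries-upper (suc c) as))

entries-sorted : ∀ c as → AllPairs _≤_ (entries c as)
entries-sorted c [] = []
entries-sorted c (a ∷ as) = AllPairsP.++⁺ (replicate-sorted a c) (entries-sorted (suc c) as)
  (AllP.replicate⁺ a (All.map (ℕP.≤-trans (ℕP.n≤1+n c)) (entries-lower (suc c) as)))

entries-suc : ∀ c as → entries (suc c) as ≡ map suc (entries c as)
entries-suc c [] = refl
entries-suc c (a ∷ as) = sym (trans (ListP.map-++ suc (replicate a c) (entries (suc c) as))
  (cong₂ _++_ (ListP.map-replicate suc a c) (sym (entries-suc (suc c) as))))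

entries-∷ʳ : ∀ c as a → entries c (as ++ a ∷ []) ≡ entries c as ++ replicate a (c + length as)
entries-∷ʳ c [] a = trans (ListP.++-identityʳ _) (cong (replicate a) (sym (ℕP.+-identityʳ c)))
entries-∷ʳ c (a′ ∷ as) a = begin
  replicate a′ c ++ entries (suc c) (as ++ a ∷ [])
    ≡⟨ cong (replicate a′ c ++_) (entries-∷ʳ (suc c) as a) ⟩
  replicate a′ c ++ (entries (suc c) as ++ replicate a (suc c + length as))
    ≡⟨ ListP.++-assoc (replicate a′ c) _ _ ⟨
  (replicate a′ c ++ entries (suc c) as) ++ replicate a (suc c + length as)
    ≡⟨ cong (λ t → (replicate a′ c ++ entries (suc c) as) ++ replicate a t) (ℕP.+-suc c (length as)) ⟨
  (replicate a′ c ++ entries (suc c) as) ++ replicate a (c + suc (length as))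
    ∎
  where open ≡-Reasoning

reverse-replicate : ∀ n (c : ℕ) → reverse (replicate n c) ≡ replicate n c
reverse-replicate zero c = refl
reverse-replicate (suc n) c = begin
  reverse (replicate (suc n) c)   ≡⟨ ListP.unfold-reverse c (replicate n c) ⟩
  reverse (replicate n c) ++ c ∷ [] ≡⟨ cong (_++ c ∷ []) (reverse-replicate n c) ⟩
  replicate n c ++ c ∷ []         ≡⟨ replicate-∷ʳ n ⟩
  replicate (suc n) c             ∎
  where
  open ≡-Reasoning
  replicate-∷ʳ : ∀ n → replicate n c ++ c ∷ [] ≡ c ∷ replicate n c
  replicate-∷ʳ zero = refl
  replicate-∷ʳ (suc n) = cong (c ∷_) (replicate-∷ʳ n)

lam-reverse : ∀ a → lam (reverse a) ≡ reverse (map (suc (length a) ∸_) (lam a))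
lam-reverse [] = refl
lam-reverse (a ∷ as) = begin
  entries 1 (reverse (a ∷ as))
    ≡⟨ cong (entries 1) (ListP.unfold-reverse a as) ⟩
  entries 1 (reverse as ++ a ∷ [])
    ≡⟨ entries-∷ʳ 1 (reverse as) a ⟩
  entries 1 (reverse as) ++ replicate a (suc (length (reverse as)))
    ≡⟨ cong₂ _++_ (lam-reverse as) (cong (replicate a ∘ suc) (ListP.length-reverse as)) ⟩
  reverse (map (suc m ∸_) (entries 1 as)) ++ replicate a (suc m)
    ≡⟨ cong₂ _++_ (cong reverse tail≡) head≡ ⟨
  reverse (map f (entries 2 as)) ++ reverse (map f (replicate a 1))
    ≡⟨ ListP.reverse-++ (map f (replicate a 1)) (map f (entries 2 as)) ⟨
  reverse (map f (replicate a 1) ++ map f (entries 2 as))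
    ≡⟨ cong reverse (ListP.map-++ f (replicate a 1) (entries 2 as)) ⟨
  reverse (map f (entries 1 (a ∷ as)))
    ∎
  where
  open ≡-Reasoning
  m : ℕ
  m = length as
  f : ℕ → ℕ
  f = suc (suc m) ∸_
  tail≡ : map f (entries 2 as) ≡ map (suc m ∸_) (entries 1 as)
  tail≡ = trans (cong (map f) (entries-suc 1 as)) (sym (ListP.map-∘ (entries 1 as)))
  head≡ : reverse (map f (replicate a 1)) ≡ replicate a (suc m)
  head≡ = trans (cong reverse (ListP.map-replicate f a 1)) (reverse-replicate a _)

length-lam-reverse : ∀ a → length (lam (reverse a)) ≡ length (lam a)
length-lam-reverse a = begin
  length (lam (reverse a))
    ≡⟨ cong length (lam-reverse a) ⟩
  length (reverse (map (suc (length a) ∸_) (lam a)))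
    ≡⟨ ListP.length-reverse (map (suc (length a) ∸_) (lam a)) ⟩
  length (map (suc (length a) ∸_) (lam a))
    ≡⟨ ListP.length-map _ (lam a) ⟩
  length (lam a)
    ∎
  where open ≡-Reasoning

lam-reverse-dual : ∀ a → Duality.Dual (length (lam a)) (suc (length a)) (lam a) (lam (reverse a))
lam-reverse-dual a i 1≤i i≤N = begin
  nth (lam (reverse a)) i + nth L j
    ≡⟨ cong (_+ nth L j) reversed ⟩
  (suc m ∸ nth L j) + nth L j
    ≡⟨ ℕP.m∸n+n≡m (nth-≤ L (entries-upper 1 a) j) ⟩
  suc m
    ∎
  where
  open ≡-Reasoning
  L : List ℕ
  L = lam a
  N : ℕ
  N = length L
  m : ℕ
  m = length a
  j : ℕ
  j = suc N ∸ i
  ∣mapL∣≡N : length (map (suc m ∸_) L) ≡ N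
  ∣mapL∣≡N = ListP.length-map (suc m ∸_) L
  1≤j : 1 ≤ j
  1≤j = subst (1 ≤_) (sym (ℕP.+-∸-assoc 1 i≤N)) (s≤s z≤n)
  j≤N : j ≤ N
  j≤N = ℕP.∸-monoʳ-≤ (suc N) 1≤i
  reversed : nth (lam (reverse a)) i ≡ suc m ∸ nth L j
  reversed = begin
    nth (lam (reverse a)) i
      ≡⟨ cong (λ l → nth l i) (lam-reverse a) ⟩
    nth (reverse (map (suc m ∸_) L)) i
      ≡⟨ nth-reverse (map (suc m ∸_) L) 1≤i (subst (i ≤_) (sym ∣mapL∣≡N) i≤N) ⟩
    nth (map (suc m ∸_) L) (suc (length (map (suc m ∸_) L)) ∸ i)
      ≡⟨ cong (λ t → nth (map (suc m ∸_) L) (suc t ∸ i)) ∣mapL∣≡N ⟩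
    nth (map (suc m ∸_) L) j
      ≡⟨ nth-map (suc m ∸_) L 1≤j j≤N ⟩
    suc m ∸ nth L j
      ∎

firstBlock : ∀ a → 2 ≤ length a → nth a 1 ≡ 1 → ContainsSym (lam a) (nth a 2)
firstBlock (_ ∷ []) (s≤s ()) _
firstBlock (_ ∷ k ∷ rest) _ refl = GapPermutation.containsSym (lam (1 ∷ k ∷ rest)) k k<n 2
  (nth-mono (entries-sorted 1 (1 ∷ k ∷ rest))) block (λ ())
  where
  block : ∀ t → 2 ≤ t → t ≤ suc k → nth (lam (1 ∷ k ∷ rest)) t ≡ 2
  block (suc zero) (s≤s ()) _
  block (suc (suc t)) _ (s≤s t<k) = nth-replicate-++ k 2 (entries 3 rest) t<k
  k<n : k < length (lam (1 ∷ k ∷ rest))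
  k<n = s≤s (subst (k ≤_) (sym (ListP.length-++ (replicate k 2) {entries 3 rest}))
          (subst (λ t → k ≤ t + _) (sym (ListP.length-replicate k)) (ℕP.m≤m+n k _)))

lastBlock : ∀ a → 2 ≤ length a → nth a (length a) ≡ 1 → ContainsSym (lam a) (nth a (length a ∸ 1))
lastBlock a 2≤m aₘ≡1 = ContainsSym-transport (dualFaceIso refl (length-lam-reverse a) (lam-reverse-dual a))
  (subst (ContainsSym (lam (reverse a))) (nth-reverse a (s≤s z≤n) 2≤m)
    (firstBlock (reverse a) (subst (2 ≤_) (sym (ListP.length-reverse a)) 2≤m)
      (trans (nth-reverse a (s≤s z≤n) (ℕP.≤-trans (s≤s z≤n) 2≤m)) aₘ≡1)))
  where open Duality (length (lam a)) (suc (length a))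

proposition4p3 : (a : List ℕ) → All (1 ≤_) a → 2 ≤ length a →
    ((nth a 1 ≡ 1 → ContainsSym (lam a) (nth a 2)) ×
     (nth a (length a) ≡ 1 → ContainsSym (lam a) (nth a (length a ∸ 1))))
proposition4p3 a _ 2≤m = firstBlock a 2≤m , lastBlock a 2≤m  -- block sizes may be zero
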